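{- In $\mathsf{GT}^-$: ($\mathsf{L}\neg$) $\vdash^{n} \Gamma ,\neg \alpha\Rightarrow \Delta$ implies $\vdash^{n} \Gamma\Rightarrow\alpha , \Delta$; ($\mathsf{R}\neg$) $\vdash^{n} \Gamma \Rightarrow \neg \alpha,\Delta$ implies $\vdash^{n} \Gamma,\alpha \Rightarrow \Delta$; ($\mathsf{L}\wedge$) $\vdash^{n} \Gamma, \phi\wedge\psi \Rightarrow \Delta$ implies $\vdash^{n} \Gamma, \phi,\psi \Rightarrow \Delta$; ($\mathsf{R}\wedge$) $\vdash^{n} \Gamma \Rightarrow \phi\wedge\psi,\Delta$ implies $\vdash^{n} \Gamma \Rightarrow \phi,\Delta$ and $\vdash^{n} \Gamma \Rightarrow \psi,\Delta$; ($\mathsf{L}\vee$) $\vdash^{n} \Gamma, \phi\vee\psi \Rightarrow \Delta$ implies $\vdash^{n} \Gamma, \phi\Rightarrow \Delta$ and $\vdash^{n} \Gamma, \psi\Rightarrow \Delta$; ($\mathsf{R}\vee$) $\vdash^{n} \Gamma \Rightarrow \phi \vee \psi,\Delta$ implies $\vdash^{n} \Gamma \Rightarrow \phi,\psi,\Delta$; ($\mathsf{L}\mathbin{\backslash\!\!\!/}$) $\vdash^{n} \Gamma, \chi\{\phi_L\mathbin{\backslash\!\!\!/}\phi_R\} \Rightarrow \Delta$ implies $\vdash^{n} \Gamma, \chi\{\phi_L\}\Rightarrow \Delta$ and $\vdash^{n} \Gamma, \chi\{\phi_R\}\Rightarrow \Delta$; ($\mathsf{R}\mathbin{\backslash\!\!\!/}$)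 $\vdash^{n} \Xi \Rightarrow \chi\{\phi_L\mathbin{\backslash\!\!\!/}\phi_R\},\Delta$ implies $\vdash^{n} \Xi\Rightarrow \chi\{\phi_L\}, \Delta$ or $\vdash^{n} \Xi\Rightarrow \chi\{\phi_R\},\Delta$.
   Context: Formulas: classical formulas $\alpha::=p\mid\bot\mid\neg\alpha\mid\alpha\wedge\alpha\mid\alpha\vee\alpha$; formulas of $\mathbf{PL}(\mathbin{\backslash\!\!\!/})$: $\phi::=\alpha\mid\phi\wedge\phi\mid\phi\vee\phi\mid\phi\mathbin{\backslash\!\!\!/}\phi$ ($\vee$ split disjunction, $\mathbin{\backslash\!\!\!/}$ inquisitive disjunction). $\alpha$ ranges over classical formulas; $\Xi,\Lambda$ range over finite multisets of classical formulas. $\mathsf{GT}^-$ is the cut-free calculus with axioms $\Gamma,p\Rightarrow p,\Delta$, $\Gamma,\bot\Rightarrow\Delta$ and rules: $\mathsf{L}\neg$ ($\Gamma\Rightarrow\alpha,\Delta$ / $\Gamma,\neg\alpha\Rightarrow\Delta$), $\mathsf{R}\neg$ ($\Gamma,\alpha\Rightarrow\Delta$ / $\Gamma\Rightarrow\neg\alpha,\Delta$), $\mathsf{L}\wedge$ ($\Gamma,\phi,\psi\Rightarrow\Delta$ / $\Gamma,\phi\wedge\psi\Rightarrow\Delta$), $\mathsf{R}\wedge$ ($\Gamma\Rightarrow\phi,\Lambda$ and $\Gamma\Rightarrow\psi,\Lambda$ / $\Gamma\Rightarrow\phi\wedge\psi,\Lambda,\Delta$), $\mathsf{L}\vee$ ($\Gamma,\phi\Rightarrow\Lambda$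 and $\Gamma,\psi\Rightarrow\Lambda$ / $\Gamma,\phi\vee\psi\Rightarrow\Lambda,\Delta$), $\mathsf{R}\vee$ ($\Gamma\Rightarrow\phi,\psi,\Delta$ / $\Gamma\Rightarrow\phi\vee\psi,\Delta$), $\mathsf{L}\mathbin{\backslash\!\!\!/}$ ($\Gamma,\chi\{\phi_L\}\Rightarrow\Delta$ and $\Gamma,\chi\{\phi_R\}\Rightarrow\Delta$ / $\Gamma,\chi\{\phi_L\mathbin{\backslash\!\!\!/}\phi_R\}\Rightarrow\Delta$), $\mathsf{R}\mathbin{\backslash\!\!\!/}$ ($\Gamma\Rightarrow\chi\{\phi_i\},\Delta$, $i\in\{L,R\}$ / $\Gamma\Rightarrow\chi\{\phi_L\mathbin{\backslash\!\!\!/}\phi_R\},\Delta$), where $\chi\{\eta\}$ replaces a fixed subformula occurrence of $\chi$ not in the scope of a negation by $\eta$. Height: a single axiom has height 1, otherwise 1 plus the maximum premise height. $\vdash^n\Gamma\Rightarrow\Delta$ means there is a $\mathsf{GT}^-$-derivation of $\Gamma\Rightarrow\Delta$ of height at most $n$. -}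

module Defs where

open import Data.Nat using (ℕ; suc; _⊔_)
open import Data.Bool using (Bool; true; false; _∧_; T)
open import Data.List using (List; []; _∷_; _++_)
open import Data.List.Relation.Unary.All using (All)
open import Data.List.Relation.Binary.Permutation.Propositional using (_↭_)

-- Negation may only be applied to classical
-- formulas (those not containing the inquisitive disjunction ⩔), so
-- the type of formulas and the "is classical" test are defined by
-- induction-recursion.  'classical' formulas are exactly the α's.

infixr 6 _∧'_
infixr 5 _∨'_
infixr 4 _⩔_

mutual
  data Fm : Set where
    atom : ℕ → Fm
    ⊥'   : Fm
    ¬'   : (α : Fm) → {c : T (classical α)} → Fm
    _∧'_ : Fm → Fm → Fm
    _∨'_ : Fm → Fm → Fm
    _⩔_  : Fm → Fm → Fm

  classical : Fm → Bool
  classical (atom _) = true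
  classical ⊥'       = true
  classical (¬' _)   = true
  classical (φ ∧' ψ) = classical φ ∧ classical ψ
  classical (φ ∨' ψ) = classical φ ∧ classical ψ
  classical (φ ⩔ ψ)  = false

Classical : Fm → Set
Classical φ = T (classical φ)

-- χ{η}: a formula χ with a fixed subformula occurrence, not in the scope
-- of a negation, replaced by η.  One-hole contexts without a negation
-- constructor.

data Ctx : Set where
  hole : Ctx
  ∧ₗ   : Ctx → Fm → Ctx
  ∧ᵣ   : Fm → Ctx → Ctx
  ∨ₗ   : Ctx → Fm → Ctx
  ∨ᵣ   : Fm → Ctx → Ctx
  ⩔ₗ   : Ctx → Fm → Ctx
  ⩔ᵣ   : Fm → Ctx → Ctx

_⟦_⟧ : Ctx → Fm → Fm
hole     ⟦ η ⟧ = η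
∧ₗ χ ψ   ⟦ η ⟧ = (χ ⟦ η ⟧) ∧' ψ
∧ᵣ φ χ   ⟦ η ⟧ = φ ∧' (χ ⟦ η ⟧)
∨ₗ χ ψ   ⟦ η ⟧ = (χ ⟦ η ⟧) ∨' ψ
∨ᵣ φ χ   ⟦ η ⟧ = φ ∨' (χ ⟦ η ⟧)
⩔ₗ χ ψ   ⟦ η ⟧ = (χ ⟦ η ⟧) ⩔ ψ
⩔ᵣ φ χ   ⟦ η ⟧ = φ ⩔ (χ ⟦ η ⟧)

-- Sequents Γ ⇒ Δ have finite multisets as sides,
-- represented by lists; every rule concludes any sequent whose sides
-- are permutations (_↭_) of the displayed multisets, so derivability is
-- a relation on multisets.  "Γ , φ" is rendered as φ ∷ Γ.

data GT : List Fm → List Fm → Set where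
  ax   : ∀ {Γ Δ Γ' Δ'} p →
         Γ' ↭ atom p ∷ Γ → Δ' ↭ atom p ∷ Δ → GT Γ' Δ'
  ax⊥  : ∀ {Γ Γ' Δ} →
         Γ' ↭ ⊥' ∷ Γ → GT Γ' Δ
  L¬   : ∀ {Γ Γ' Δ} α {c : Classical α} →
         GT Γ (α ∷ Δ) → Γ' ↭ ¬' α {c} ∷ Γ → GT Γ' Δ
  R¬   : ∀ {Γ Δ Δ'} α {c : Classical α} →
         GT (α ∷ Γ) Δ → Δ' ↭ ¬' α {c} ∷ Δ → GT Γ Δ'
  L∧   : ∀ {Γ Γ' Δ} φ ψ →
         GT (φ ∷ ψ ∷ Γ) Δ → Γ' ↭ (φ ∧' ψ) ∷ Γ → GT Γ' Δ
  R∧   : ∀ {Γ Λ Δ Δ'} φ ψ → All Classical Λ →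
         GT Γ (φ ∷ Λ) → GT Γ (ψ ∷ Λ) →
         Δ' ↭ (φ ∧' ψ) ∷ (Λ ++ Δ) → GT Γ Δ'
  L∨   : ∀ {Γ Γ' Λ Δ Δ'} φ ψ → All Classical Λ →
         GT (φ ∷ Γ) Λ → GT (ψ ∷ Γ) Λ →
         Γ' ↭ (φ ∨' ψ) ∷ Γ → Δ' ↭ Λ ++ Δ → GT Γ' Δ'
  R∨   : ∀ {Γ Δ Δ'} φ ψ →
         GT Γ (φ ∷ ψ ∷ Δ) → Δ' ↭ (φ ∨' ψ) ∷ Δ → GT Γ Δ'
  L⩔   : ∀ {Γ Γ' Δ} χ φL φR →
         GT (χ ⟦ φL ⟧ ∷ Γ) Δ → GT (χ ⟦ φR ⟧ ∷ Γ) Δ →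
         Γ' ↭ χ ⟦ φL ⩔ φR ⟧ ∷ Γ → GT Γ' Δ
  R⩔L  : ∀ {Γ Δ Δ'} χ φL φR →
         GT Γ (χ ⟦ φL ⟧ ∷ Δ) → Δ' ↭ χ ⟦ φL ⩔ φR ⟧ ∷ Δ → GT Γ Δ'
  R⩔R  : ∀ {Γ Δ Δ'} χ φL φR →
         GT Γ (χ ⟦ φR ⟧ ∷ Δ) → Δ' ↭ χ ⟦ φL ⩔ φR ⟧ ∷ Δ → GT Γ Δ'

height : ∀ {Γ Δ} → GT Γ Δ → ℕ
height (ax _ _ _)            = 1
height (ax⊥ _)               = 1
height (L¬ _ d _)            = suc (height d)
height (R¬ _ d _)            = suc (height d)
height (L∧ _ _ d _)          = suc (height d)
height (R∧ _ _ _ d e _)      = suc (height d ⊔ height e)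
height (L∨ _ _ _ d e _ _)    = suc (height d ⊔ height e)
height (R∨ _ _ d _)          = suc (height d)
height (L⩔ _ _ _ d e _)      = suc (height d ⊔ height e)
height (R⩔L _ _ _ d _)       = suc (height d)
height (R⩔R _ _ _ d _)       = suc (height d)

open import Data.Nat using (_≤_)
open import Data.Product using (Σ)

⊢[_]_⇒_ : ℕ → List Fm → List Fm → Set
⊢[ n ] Γ ⇒ Δ = Σ (GT Γ Δ) (λ d → height d ≤ n)

{-# OPTIONS --safe #-}
-- Each inversion is proved by induction on the derivation, following the
-- inverted occurrence through the permutations built into every rule.  If the
-- occurrence is not principal, the last rule is reapplied to the inverted
-- premises; for R∧ and L∨ the formulas thereby added to the classical part Λ
-- of the succedent are classical, being parts of a classical formula.  If it
-- is principal for the rule being inverted, a premise is the result.  If it is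
-- principal for another rule (a ⩔ resolved inside a conjunction introduced by
-- L∧, a conjunction inverted inside the principal formula of an L⩔, ...), the
-- induction hypothesis is applied to the premises and the rule reapplied.  The
-- case of ⩔ against ⩔ rests on the fact that two ⩔-occurrences of a formula
-- are equal, nested or disjoint, and in each case resolving one commutes with
-- splitting at the other (split-⇝-commute).  Inverting ⩔ on the right only
-- yields one of the two resolutions, and needs a classical antecedent, since
-- the two premises of an L⩔ could otherwise choose differently.
module Submission where

open import Defs
open import Data.Bool using (T; _∧_)
open import Data.Bool.Properties using (T-∧)
open import Data.Empty using (⊥-elim)
open import Data.List using (List; []; _∷_; _++_)
open import Data.List.Membership.Propositional using (_∈_)
open import Data.List.Membership.Propositional.Properties using (∈-∃++; ∈-++⁻)
open import Data.List.Relation.Unary.All using (All; []; _∷_; head; tail)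
open import Data.List.Relation.Unary.All.Properties using (++⁺)
open import Data.List.Relation.Unary.Any using (here; there)
open import Data.List.Relation.Binary.Permutation.Propositional
  using (_↭_; ↭-refl; ↭-prep; ↭-swap; ↭-trans; ↭-sym)
open import Data.List.Relation.Binary.Permutation.Propositional.Properties
  using (∈-resp-↭; All-resp-↭; drop-∷; shift; shifts; ++⁺ˡ; ++⁺ʳ; ++-comm; ++-identityʳ; ++-assoc)
open import Data.Nat using (ℕ; suc; _⊔_; _≤_; s≤s)
open import Data.Nat.Properties using (≤-refl; ≤-trans; ⊔-mono-≤; m≤m⊔n; m≤n⊔m; n≤1+n)
open import Data.Product using (∃-syntax; _×_; _,_; proj₁; proj₂)
open import Data.Sum using (_⊎_; inj₁; inj₂) renaming (map to map⊎)
open import Data.Unit using (tt)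
open import Function using (Equivalence; id)
open import Relation.Binary.Construct.Closure.Reflexive using (ReflClosure; refl; [_])
import Relation.Binary.Construct.Closure.Reflexive as Refl
open import Relation.Binary.PropositionalEquality using (_≡_; refl)
open import Relation.Nullary using (¬_)

private variable
  n m k : ℕ
  α φ φ₁ φ₂ φ' ψ ψ₁ ψ₂ ψ' τ τ' τ₁ τ₂ σ σ₁ σ₂ ρ₁ ρ₂ x y : Fm
  xs ys zs Γ Γ' Γ₀ Γ₊ Δ Δ' Δ₀ Δ₊ Λ Λ₀ L R : List Fm

∈⇒↭∷ : x ∈ xs → ∃[ ys ] xs ↭ x ∷ ys
∈⇒↭∷ x∈xs with ys , zs , refl ← ∈-∃++ x∈xs = ys ++ zs , shift _ ys zs

prefix-↭-∷ : ∀ L → xs ↭ x ∷ ys → L ++ xs ↭ x ∷ L ++ ys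
prefix-↭-∷ L p = ↭-trans (++⁺ˡ L p) (shift _ L _)

↭-∷-overlap : xs ↭ x ∷ ys → xs ↭ y ∷ zs →
              (x ≡ y × ys ↭ zs) ⊎ ∃[ ws ] (ys ↭ y ∷ ws × zs ↭ x ∷ ws)
↭-∷-overlap p q with ∈-resp-↭ (↭-trans (↭-sym q) p) (here refl)
... | here refl = inj₁ (refl , drop-∷ (↭-trans (↭-sym p) q))
... | there y∈ys with ws , r ← ∈⇒↭∷ y∈ys =
  inj₂ (ws , r , drop-∷ (↭-trans (↭-sym q) (↭-trans p (prefix-↭-∷ (_ ∷ []) r))))

∷↭++-inv : x ∷ xs ↭ ys ++ zs →
           (∃[ ys' ] (ys ↭ x ∷ ys' × xs ↭ ys' ++ zs)) ⊎ (∃[ zs' ] (zs ↭ x ∷ zs' × xs ↭ ys ++ zs'))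
∷↭++-inv {ys = ys} {zs} p with ∈-++⁻ ys (∈-resp-↭ p (here refl))
... | inj₁ x∈ys with ys' , r ← ∈⇒↭∷ x∈ys =
  inj₁ (ys' , r , drop-∷ (↭-trans p (++⁺ʳ zs r)))
... | inj₂ x∈zs with zs' , r ← ∈⇒↭∷ x∈zs =
  inj₂ (zs' , r , drop-∷ (↭-trans p (prefix-↭-∷ ys r)))

-- Split τ τ₁ τ₂ says that (τ , τ₁ , τ₂) is (χ ⟦ φ ⩔ ψ ⟧ , χ ⟦ φ ⟧ , χ ⟦ ψ ⟧)
-- for some χ φ ψ (⟦⟧-split, split-plugged).  Unlike the function _⟦_⟧ it
-- can be pattern matched, which is how two occurrences are compared.
data Split : Fm → Fm → Fm → Set where
  hole : Split (φ ⩔ ψ) φ ψ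
  ∧ₗ   : Split φ φ₁ φ₂ → Split (φ ∧' ψ) (φ₁ ∧' ψ) (φ₂ ∧' ψ)
  ∧ᵣ   : Split ψ ψ₁ ψ₂ → Split (φ ∧' ψ) (φ ∧' ψ₁) (φ ∧' ψ₂)
  ∨ₗ   : Split φ φ₁ φ₂ → Split (φ ∨' ψ) (φ₁ ∨' ψ) (φ₂ ∨' ψ)
  ∨ᵣ   : Split ψ ψ₁ ψ₂ → Split (φ ∨' ψ) (φ ∨' ψ₁) (φ ∨' ψ₂)
  ⩔ₗ   : Split φ φ₁ φ₂ → Split (φ ⩔ ψ) (φ₁ ⩔ ψ) (φ₂ ⩔ ψ)
  ⩔ᵣ   : Split ψ ψ₁ ψ₂ → Split (φ ⩔ ψ) (φ ⩔ ψ₁) (φ ⩔ ψ₂)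

infix 3 _⇝_ _⇝⁼_

data _⇝_ : Fm → Fm → Set where
  pickₗ : φ ⩔ ψ ⇝ φ
  pickᵣ : φ ⩔ ψ ⇝ ψ
  ∧ₗ    : φ ⇝ φ' → φ ∧' ψ ⇝ φ' ∧' ψ
  ∧ᵣ    : ψ ⇝ ψ' → φ ∧' ψ ⇝ φ ∧' ψ'
  ∨ₗ    : φ ⇝ φ' → φ ∨' ψ ⇝ φ' ∨' ψ
  ∨ᵣ    : ψ ⇝ ψ' → φ ∨' ψ ⇝ φ ∨' ψ'
  ⩔ₗ    : φ ⇝ φ' → φ ⩔ ψ ⇝ φ' ⩔ ψ
  ⩔ᵣ    : ψ ⇝ ψ' → φ ⩔ ψ ⇝ φ ⩔ ψ'

_⇝⁼_ : Fm → Fm → Set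
_⇝⁼_ = ReflClosure _⇝_

⟦⟧-split : ∀ χ φ ψ → Split (χ ⟦ φ ⩔ ψ ⟧) (χ ⟦ φ ⟧) (χ ⟦ ψ ⟧)
⟦⟧-split hole     φ ψ = hole
⟦⟧-split (∧ₗ χ _) φ ψ = ∧ₗ (⟦⟧-split χ φ ψ)
⟦⟧-split (∧ᵣ _ χ) φ ψ = ∧ᵣ (⟦⟧-split χ φ ψ)
⟦⟧-split (∨ₗ χ _) φ ψ = ∨ₗ (⟦⟧-split χ φ ψ)
⟦⟧-split (∨ᵣ _ χ) φ ψ = ∨ᵣ (⟦⟧-split χ φ ψ)
⟦⟧-split (⩔ₗ χ _) φ ψ = ⩔ₗ (⟦⟧-split χ φ ψ)
⟦⟧-split (⩔ᵣ _ χ) φ ψ = ⩔ᵣ (⟦⟧-split χ φ ψ)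

⟦⟧-⇝ₗ : ∀ χ φ ψ → χ ⟦ φ ⩔ ψ ⟧ ⇝ χ ⟦ φ ⟧
⟦⟧-⇝ₗ hole     φ ψ = pickₗ
⟦⟧-⇝ₗ (∧ₗ χ _) φ ψ = ∧ₗ (⟦⟧-⇝ₗ χ φ ψ)
⟦⟧-⇝ₗ (∧ᵣ _ χ) φ ψ = ∧ᵣ (⟦⟧-⇝ₗ χ φ ψ)
⟦⟧-⇝ₗ (∨ₗ χ _) φ ψ = ∨ₗ (⟦⟧-⇝ₗ χ φ ψ)
⟦⟧-⇝ₗ (∨ᵣ _ χ) φ ψ = ∨ᵣ (⟦⟧-⇝ₗ χ φ ψ)
⟦⟧-⇝ₗ (⩔ₗ χ _) φ ψ = ⩔ₗ (⟦⟧-⇝ₗ χ φ ψ)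
⟦⟧-⇝ₗ (⩔ᵣ _ χ) φ ψ = ⩔ᵣ (⟦⟧-⇝ₗ χ φ ψ)

⟦⟧-⇝ᵣ : ∀ χ φ ψ → χ ⟦ φ ⩔ ψ ⟧ ⇝ χ ⟦ ψ ⟧
⟦⟧-⇝ᵣ hole     φ ψ = pickᵣ
⟦⟧-⇝ᵣ (∧ₗ χ _) φ ψ = ∧ₗ (⟦⟧-⇝ᵣ χ φ ψ)
⟦⟧-⇝ᵣ (∧ᵣ _ χ) φ ψ = ∧ᵣ (⟦⟧-⇝ᵣ χ φ ψ)
⟦⟧-⇝ᵣ (∨ₗ χ _) φ ψ = ∨ₗ (⟦⟧-⇝ᵣ χ φ ψ)
⟦⟧-⇝ᵣ (∨ᵣ _ χ) φ ψ = ∨ᵣ (⟦⟧-⇝ᵣ χ φ ψ)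
⟦⟧-⇝ᵣ (⩔ₗ χ _) φ ψ = ⩔ₗ (⟦⟧-⇝ᵣ χ φ ψ)
⟦⟧-⇝ᵣ (⩔ᵣ _ χ) φ ψ = ⩔ᵣ (⟦⟧-⇝ᵣ χ φ ψ)

data Plugged : Fm → Fm → Fm → Set where
  plug : ∀ χ φ ψ → Plugged (χ ⟦ φ ⩔ ψ ⟧) (χ ⟦ φ ⟧) (χ ⟦ ψ ⟧)

split-plugged : Split τ τ₁ τ₂ → Plugged τ τ₁ τ₂
split-plugged hole = plug hole _ _
split-plugged (∧ₗ s) with plug χ φ ψ ← split-plugged s = plug (∧ₗ χ _) φ ψ
split-plugged (∧ᵣ s) with plug χ φ ψ ← split-plugged s = plug (∧ᵣ _ χ) φ ψ
split-plugged (∨ₗ s) with plug χ φ ψ ← split-plugged s = plug (∨ₗ χ _) φ ψ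
split-plugged (∨ᵣ s) with plug χ φ ψ ← split-plugged s = plug (∨ᵣ _ χ) φ ψ
split-plugged (⩔ₗ s) with plug χ φ ψ ← split-plugged s = plug (⩔ₗ χ _) φ ψ
split-plugged (⩔ᵣ s) with plug χ φ ψ ← split-plugged s = plug (⩔ᵣ _ χ) φ ψ

data PluggedStep : Fm → Fm → Set where
  plugₗ : ∀ χ φ ψ → PluggedStep (χ ⟦ φ ⩔ ψ ⟧) (χ ⟦ φ ⟧)
  plugᵣ : ∀ χ φ ψ → PluggedStep (χ ⟦ φ ⩔ ψ ⟧) (χ ⟦ ψ ⟧)

⇝-plugged : τ ⇝ τ' → PluggedStep τ τ'
⇝-plugged pickₗ = plugₗ hole _ _
⇝-plugged pickᵣ = plugᵣ hole _ _
⇝-plugged (∧ₗ t) with ⇝-plugged t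
... | plugₗ χ φ ψ = plugₗ (∧ₗ χ _) φ ψ
... | plugᵣ χ φ ψ = plugᵣ (∧ₗ χ _) φ ψ
⇝-plugged (∧ᵣ t) with ⇝-plugged t
... | plugₗ χ φ ψ = plugₗ (∧ᵣ _ χ) φ ψ
... | plugᵣ χ φ ψ = plugᵣ (∧ᵣ _ χ) φ ψ
⇝-plugged (∨ₗ t) with ⇝-plugged t
... | plugₗ χ φ ψ = plugₗ (∨ₗ χ _) φ ψ
... | plugᵣ χ φ ψ = plugᵣ (∨ₗ χ _) φ ψ
⇝-plugged (∨ᵣ t) with ⇝-plugged t
... | plugₗ χ φ ψ = plugₗ (∨ᵣ _ χ) φ ψ
... | plugᵣ χ φ ψ = plugᵣ (∨ᵣ _ χ) φ ψ
⇝-plugged (⩔ₗ t) with ⇝-plugged t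
... | plugₗ χ φ ψ = plugₗ (⩔ₗ χ _) φ ψ
... | plugᵣ χ φ ψ = plugᵣ (⩔ₗ χ _) φ ψ
⇝-plugged (⩔ᵣ t) with ⇝-plugged t
... | plugₗ χ φ ψ = plugₗ (⩔ᵣ _ χ) φ ψ
... | plugᵣ χ φ ψ = plugᵣ (⩔ᵣ _ χ) φ ψ

∧-classical : ∀ φ ψ → T (classical φ ∧ classical ψ) → Classical φ × Classical ψ
∧-classical φ ψ = Equivalence.to (T-∧ {classical φ})

split-nonclassical : Split τ τ₁ τ₂ → ¬ Classical τ
split-nonclassical hole ()
split-nonclassical (∧ₗ {φ = φ} {ψ = ψ} s) c = split-nonclassical s (proj₁ (∧-classical φ ψ c))
split-nonclassical (∧ᵣ {ψ = ψ} {φ = φ} s) c = split-nonclassical s (proj₂ (∧-classical φ ψ c))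
split-nonclassical (∨ₗ {φ = φ} {ψ = ψ} s) c = split-nonclassical s (proj₁ (∧-classical φ ψ c))
split-nonclassical (∨ᵣ {ψ = ψ} {φ = φ} s) c = split-nonclassical s (proj₂ (∧-classical φ ψ c))
split-nonclassical (⩔ₗ s) ()
split-nonclassical (⩔ᵣ s) ()

data Commutes (σ₁ σ₂ τ : Fm) : Set where
  from₁ : σ₁ ⇝⁼ τ → Commutes σ₁ σ₂ τ
  from₂ : σ₂ ⇝⁼ τ → Commutes σ₁ σ₂ τ
  both  : Split τ ρ₁ ρ₂ → σ₁ ⇝⁼ ρ₁ → σ₂ ⇝⁼ ρ₂ → Commutes σ₁ σ₂ τ

Commutes-map : (f : Fm → Fm) →
               (∀ {φ φ₁ φ₂} → Split φ φ₁ φ₂ → Split (f φ) (f φ₁) (f φ₂)) →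
               (∀ {φ φ'} → φ ⇝ φ' → f φ ⇝ f φ') →
               Commutes σ₁ σ₂ τ → Commutes (f σ₁) (f σ₂) (f τ)
Commutes-map f f-split f-step (from₁ r)      = from₁ (Refl.map f-step r)
Commutes-map f f-split f-step (from₂ r)      = from₂ (Refl.map f-step r)
Commutes-map f f-split f-step (both s r₁ r₂) =
  both (f-split s) (Refl.map f-step r₁) (Refl.map f-step r₂)

split-⇝-commute : Split τ σ₁ σ₂ → τ ⇝ τ' → Commutes σ₁ σ₂ τ'
split-⇝-commute hole   pickₗ  = from₁ refl
split-⇝-commute hole   pickᵣ  = from₂ refl
split-⇝-commute hole   (⩔ₗ t) = both hole [ t ] refl
split-⇝-commute hole   (⩔ᵣ t) = both hole refl [ t ]
split-⇝-commute (∧ₗ s) (∧ₗ t) = Commutes-map (_∧' _) ∧ₗ ∧ₗ (split-⇝-commute s t)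
split-⇝-commute (∧ₗ s) (∧ᵣ t) = both (∧ₗ s) [ ∧ᵣ t ] [ ∧ᵣ t ]
split-⇝-commute (∧ᵣ s) (∧ₗ t) = both (∧ᵣ s) [ ∧ₗ t ] [ ∧ₗ t ]
split-⇝-commute (∧ᵣ s) (∧ᵣ t) = Commutes-map (_ ∧'_) ∧ᵣ ∧ᵣ (split-⇝-commute s t)
split-⇝-commute (∨ₗ s) (∨ₗ t) = Commutes-map (_∨' _) ∨ₗ ∨ₗ (split-⇝-commute s t)
split-⇝-commute (∨ₗ s) (∨ᵣ t) = both (∨ₗ s) [ ∨ᵣ t ] [ ∨ᵣ t ]
split-⇝-commute (∨ᵣ s) (∨ₗ t) = both (∨ᵣ s) [ ∨ₗ t ] [ ∨ₗ t ]
split-⇝-commute (∨ᵣ s) (∨ᵣ t) = Commutes-map (_ ∨'_) ∨ᵣ ∨ᵣ (split-⇝-commute s t)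
split-⇝-commute (⩔ₗ s) pickₗ  = both s [ pickₗ ] [ pickₗ ]
split-⇝-commute (⩔ₗ s) pickᵣ  = from₁ [ pickᵣ ]
split-⇝-commute (⩔ₗ s) (⩔ₗ t) = Commutes-map (_⩔ _) ⩔ₗ ⩔ₗ (split-⇝-commute s t)
split-⇝-commute (⩔ₗ s) (⩔ᵣ t) = both (⩔ₗ s) [ ⩔ᵣ t ] [ ⩔ᵣ t ]
split-⇝-commute (⩔ᵣ s) pickₗ  = from₁ [ pickₗ ]
split-⇝-commute (⩔ᵣ s) pickᵣ  = both s [ pickᵣ ] [ pickᵣ ]
split-⇝-commute (⩔ᵣ s) (⩔ₗ t) = both (⩔ᵣ s) [ ⩔ₗ t ] [ ⩔ₗ t ]
split-⇝-commute (⩔ᵣ s) (⩔ᵣ t) = Commutes-map (_ ⩔_) ⩔ᵣ ⩔ᵣ (split-⇝-commute s t)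

⊢-mono : m ≤ n → ⊢[ m ] Γ ⇒ Δ → ⊢[ n ] Γ ⇒ Δ
⊢-mono m≤n (d , h) = d , ≤-trans h m≤n

⊢-suc : ⊢[ n ] Γ ⇒ Δ → ⊢[ suc n ] Γ ⇒ Δ
⊢-suc = ⊢-mono (n≤1+n _)

⊢-⊔ˡ : ⊢[ m ] Γ ⇒ Δ → ⊢[ suc (m ⊔ k) ] Γ ⇒ Δ
⊢-⊔ˡ = ⊢-mono (≤-trans (m≤m⊔n _ _) (n≤1+n _))

⊢-⊔ʳ : ⊢[ k ] Γ ⇒ Δ → ⊢[ suc (m ⊔ k) ] Γ ⇒ Δ
⊢-⊔ʳ {m = m} = ⊢-mono (≤-trans (m≤n⊔m m _) (n≤1+n _))

atHeight : (d : GT Γ Δ) → ⊢[ height d ] Γ ⇒ Δ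
atHeight d = d , ≤-refl

⊢L¬ : {c : Classical α} → ⊢[ n ] Γ ⇒ (α ∷ Δ) → Γ' ↭ ¬' α {c} ∷ Γ → ⊢[ suc n ] Γ' ⇒ Δ
⊢L¬ (d , h) q = L¬ _ d q , s≤s h

⊢R¬ : {c : Classical α} → ⊢[ n ] (α ∷ Γ) ⇒ Δ → Δ' ↭ ¬' α {c} ∷ Δ → ⊢[ suc n ] Γ ⇒ Δ'
⊢R¬ (d , h) q = R¬ _ d q , s≤s h

⊢L∧ : ⊢[ n ] (φ ∷ ψ ∷ Γ) ⇒ Δ → Γ' ↭ φ ∧' ψ ∷ Γ → ⊢[ suc n ] Γ' ⇒ Δ
⊢L∧ (d , h) q = L∧ _ _ d q , s≤s h

⊢R∧ : All Classical Λ → ⊢[ m ] Γ ⇒ (φ ∷ Λ) → ⊢[ k ] Γ ⇒ (ψ ∷ Λ) →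
      Δ' ↭ φ ∧' ψ ∷ Λ ++ Δ → ⊢[ suc (m ⊔ k) ] Γ ⇒ Δ'
⊢R∧ cΛ (d , h) (e , h') q = R∧ _ _ cΛ d e q , s≤s (⊔-mono-≤ h h')

⊢L∨ : All Classical Λ → ⊢[ m ] (φ ∷ Γ) ⇒ Λ → ⊢[ k ] (ψ ∷ Γ) ⇒ Λ →
      Γ' ↭ (φ ∨' ψ) ∷ Γ → Δ' ↭ Λ ++ Δ → ⊢[ suc (m ⊔ k) ] Γ' ⇒ Δ'
⊢L∨ cΛ (d , h) (e , h') q r = L∨ _ _ cΛ d e q r , s≤s (⊔-mono-≤ h h')

⊢R∨ : ⊢[ n ] Γ ⇒ (φ ∷ ψ ∷ Δ) → Δ' ↭ (φ ∨' ψ) ∷ Δ → ⊢[ suc n ] Γ ⇒ Δ'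
⊢R∨ (d , h) q = R∨ _ _ d q , s≤s h

⊢L⩔ : Split τ τ₁ τ₂ → ⊢[ m ] (τ₁ ∷ Γ) ⇒ Δ → ⊢[ k ] (τ₂ ∷ Γ) ⇒ Δ →
      Γ' ↭ τ ∷ Γ → ⊢[ suc (m ⊔ k) ] Γ' ⇒ Δ
⊢L⩔ s (d , h) (e , h') q with plug χ φ ψ ← split-plugged s = L⩔ χ φ ψ d e q , s≤s (⊔-mono-≤ h h')

⊢R⩔ : τ ⇝ τ' → ⊢[ n ] Γ ⇒ (τ' ∷ Δ) → Δ' ↭ τ ∷ Δ → ⊢[ suc n ] Γ ⇒ Δ'
⊢R⩔ t (d , h) q with ⇝-plugged t
... | plugₗ χ φ ψ = R⩔L χ φ ψ d q , s≤s h
... | plugᵣ χ φ ψ = R⩔R χ φ ψ d q , s≤s h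

⊢R⩔⁼ : τ ⇝⁼ τ' → ⊢[ n ] Γ ⇒ (τ' ∷ Δ) → ⊢[ suc n ] Γ ⇒ (τ ∷ Δ)
⊢R⩔⁼ refl  d = ⊢-suc d
⊢R⩔⁼ [ t ] d = ⊢R⩔ t d ↭-refl

weaken : (d : GT Γ Δ) → Γ' ↭ Γ ++ Γ₊ → Δ' ↭ Δ ++ Δ₊ → ⊢[ height d ] Γ' ⇒ Δ'
weaken (ax p q₁ q₂) g h = ax p (↭-trans g (++⁺ʳ _ q₁)) (↭-trans h (++⁺ʳ _ q₂)) , ≤-refl
weaken (ax⊥ q) g h = ax⊥ (↭-trans g (++⁺ʳ _ q)) , ≤-refl
weaken (L¬ α d q) g h = ⊢L¬ (weaken d ↭-refl (↭-prep α h)) (↭-trans g (++⁺ʳ _ q))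
weaken (R¬ α d q) g h = ⊢R¬ (weaken d (↭-prep α g) ↭-refl) (↭-trans h (++⁺ʳ _ q))
weaken (L∧ φ ψ d q) g h = ⊢L∧ (weaken d ↭-refl h) (↭-trans g (++⁺ʳ _ q))
weaken (R∧ {Λ = Λ} φ ψ cΛ d e q) g h =
  ⊢R∧ cΛ (weaken d g (↭-sym (++-identityʳ _))) (weaken e g (↭-sym (++-identityʳ _)))
      (↭-trans h (↭-trans (++⁺ʳ _ q) (↭-prep _ (++-assoc Λ _ _))))
weaken (L∨ {Λ = Λ} φ ψ cΛ d e q r) g h =
  ⊢L∨ cΛ (weaken d ↭-refl (↭-sym (++-identityʳ _))) (weaken e ↭-refl (↭-sym (++-identityʳ _)))
      (↭-trans g (++⁺ʳ _ q)) (↭-trans h (↭-trans (++⁺ʳ _ r) (++-assoc Λ _ _)))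
weaken (R∨ φ ψ d q) g h = ⊢R∨ (weaken d g ↭-refl) (↭-trans h (++⁺ʳ _ q))
weaken (L⩔ χ φ ψ d e q) g h =
  ⊢L⩔ (⟦⟧-split χ φ ψ) (weaken d ↭-refl h) (weaken e ↭-refl h) (↭-trans g (++⁺ʳ _ q))
weaken (R⩔L χ φ ψ d q) g h = ⊢R⩔ (⟦⟧-⇝ₗ χ φ ψ) (weaken d g ↭-refl) (↭-trans h (++⁺ʳ _ q))
weaken (R⩔R χ φ ψ d q) g h = ⊢R⩔ (⟦⟧-⇝ᵣ χ φ ψ) (weaken d g ↭-refl) (↭-trans h (++⁺ʳ _ q))

⊢-weaken : ⊢[ n ] Γ ⇒ Δ → Γ' ↭ Γ ++ Γ₊ → Δ' ↭ Δ ++ Δ₊ → ⊢[ n ] Γ' ⇒ Δ'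
⊢-weaken (d , h) g h' = ⊢-mono h (weaken d g h')

⊢-exchange : ⊢[ n ] Γ ⇒ Δ → Γ ↭ Γ' → Δ ↭ Δ' → ⊢[ n ] Γ' ⇒ Δ'
⊢-exchange d g h =
  ⊢-weaken d (↭-trans (↭-sym g) (↭-sym (++-identityʳ _))) (↭-trans (↭-sym h) (↭-sym (++-identityʳ _)))

⊢-swapˡ : ⊢[ n ] (φ ∷ ψ ∷ Γ) ⇒ Δ → ⊢[ n ] (ψ ∷ φ ∷ Γ) ⇒ Δ
⊢-swapˡ d = ⊢-exchange d (↭-swap _ _ ↭-refl) ↭-refl

⊢-swapʳ : ⊢[ n ] Γ ⇒ (φ ∷ ψ ∷ Δ) → ⊢[ n ] Γ ⇒ (ψ ∷ φ ∷ Δ)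
⊢-swapʳ d = ⊢-exchange d ↭-refl (↭-swap _ _ ↭-refl)

⊢-weakenˡ : ∀ Φ Γ₊ → ⊢[ n ] (Φ ++ Γ) ⇒ Δ → ⊢[ n ] (Φ ++ Γ₊ ++ Γ) ⇒ Δ
⊢-weakenˡ Φ Γ₊ d =
  ⊢-weaken d (↭-trans (++⁺ˡ Φ (++-comm Γ₊ _)) (↭-sym (++-assoc Φ _ Γ₊))) (↭-sym (++-identityʳ _))

⊢-weakenʳ : ∀ Δ₊ → ⊢[ n ] Γ ⇒ Δ → ⊢[ n ] Γ ⇒ (Δ ++ Δ₊)
⊢-weakenʳ Δ₊ d = ⊢-weaken d (↭-sym (++-identityʳ _)) ↭-refl

data Invˡ : Fm → List Fm → List Fm → Set where
  neg     : {c : Classical α} → Invˡ (¬' α {c}) [] (α ∷ [])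
  conj    : Invˡ (φ ∧' ψ) (φ ∷ ψ ∷ []) []
  disjₗ   : Invˡ (φ ∨' ψ) (φ ∷ []) []
  disjᵣ   : Invˡ (φ ∨' ψ) (ψ ∷ []) []
  resolve : τ ⇝ τ' → Invˡ τ (τ' ∷ []) []

Invˡ-atom : ∀ {p} → ¬ Invˡ (atom p) L R
Invˡ-atom (resolve ())

Invˡ-⊥ : ¬ Invˡ ⊥' L R
Invˡ-⊥ (resolve ())

Invˡ-classical : Invˡ τ L R → All Classical R
Invˡ-classical (neg {c = c}) = c ∷ []
Invˡ-classical conj          = []
Invˡ-classical disjₗ         = []
Invˡ-classical disjᵣ         = []
Invˡ-classical (resolve _)   = []

invertˡ-L¬ : {c : Classical α} → Invˡ (¬' α {c}) L R → (d : GT Γ (α ∷ Δ)) →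
             ⊢[ suc (height d) ] (L ++ Γ) ⇒ (R ++ Δ)
invertˡ-L¬ neg d = ⊢-suc (atHeight d)

mutual
  invertˡ : Invˡ τ L R → (d : GT Γ Δ) → Γ ↭ τ ∷ Γ₀ → ⊢[ height d ] (L ++ Γ₀) ⇒ (R ++ Δ)
  invertˡ ι (ax p q₁ q₂) g with ↭-∷-overlap g q₁
  ... | inj₁ (refl , _) = ⊥-elim (Invˡ-atom ι)
  ... | inj₂ (_ , g₀ , _) = ax p (prefix-↭-∷ _ g₀) (prefix-↭-∷ _ q₂) , ≤-refl
  invertˡ ι (ax⊥ q) g with ↭-∷-overlap g q
  ... | inj₁ (refl , _) = ⊥-elim (Invˡ-⊥ ι)
  ... | inj₂ (_ , g₀ , _) = ax⊥ (prefix-↭-∷ _ g₀) , ≤-refl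
  invertˡ {L = L} ι (L¬ α d q) g with ↭-∷-overlap g q
  ... | inj₁ (refl , g₀) = ⊢-exchange (invertˡ-L¬ ι d) (++⁺ˡ L (↭-sym g₀)) ↭-refl
  ... | inj₂ (_ , g₀ , g₁) = ⊢L¬ (invertˡ-under [] (α ∷ []) ι d g₁) (prefix-↭-∷ L g₀)
  invertˡ {R = R} ι (R¬ α d q) g = ⊢R¬ (invertˡ-under (α ∷ []) [] ι d g) (prefix-↭-∷ R q)
  invertˡ {L = L} ι (L∧ φ ψ d q) g with ↭-∷-overlap g q
  ... | inj₁ (refl , g₀) = ⊢-exchange (invertˡ-L∧ ι d) (++⁺ˡ L (↭-sym g₀)) ↭-refl
  ... | inj₂ (_ , g₀ , g₁) = ⊢L∧ (invertˡ-under (φ ∷ ψ ∷ []) [] ι d g₁) (prefix-↭-∷ L g₀)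
  invertˡ {R = R} ι (R∧ {Λ = Λ} φ ψ cΛ d e q) g =
    ⊢R∧ (++⁺ (Invˡ-classical ι) cΛ)
        (invertˡ-under [] (φ ∷ []) ι d g) (invertˡ-under [] (ψ ∷ []) ι e g)
        (↭-trans (prefix-↭-∷ R q) (↭-prep _ (↭-sym (++-assoc R Λ _))))
  invertˡ {L = L} {R} ι (L∨ {Λ = Λ} φ ψ cΛ d e q r) g with ↭-∷-overlap g q
  ... | inj₁ (refl , g₀) = ⊢-exchange (invertˡ-L∨ ι cΛ d e r) (++⁺ˡ L (↭-sym g₀)) ↭-refl
  ... | inj₂ (_ , g₀ , g₁) =
    ⊢L∨ (++⁺ (Invˡ-classical ι) cΛ)
        (invertˡ-under (φ ∷ []) [] ι d g₁) (invertˡ-under (ψ ∷ []) [] ι e g₁)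
        (prefix-↭-∷ L g₀) (↭-trans (++⁺ˡ R r) (↭-sym (++-assoc R Λ _)))
  invertˡ {R = R} ι (R∨ φ ψ d q) g = ⊢R∨ (invertˡ-under [] (φ ∷ ψ ∷ []) ι d g) (prefix-↭-∷ R q)
  invertˡ {L = L} ι (L⩔ χ φ ψ d e q) g with ↭-∷-overlap g q
  ... | inj₁ (refl , g₀) =
    ⊢-exchange (invertˡ-L⩔ ι (⟦⟧-split χ φ ψ) d e) (++⁺ˡ L (↭-sym g₀)) ↭-refl
  ... | inj₂ (_ , g₀ , g₁) =
    ⊢L⩔ (⟦⟧-split χ φ ψ) (invertˡ-under (_ ∷ []) [] ι d g₁) (invertˡ-under (_ ∷ []) [] ι e g₁)
        (prefix-↭-∷ L g₀)
  invertˡ {R = R} ι (R⩔L χ φ ψ d q) g =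
    ⊢R⩔ (⟦⟧-⇝ₗ χ φ ψ) (invertˡ-under [] (_ ∷ []) ι d g) (prefix-↭-∷ R q)
  invertˡ {R = R} ι (R⩔R χ φ ψ d q) g =
    ⊢R⩔ (⟦⟧-⇝ᵣ χ φ ψ) (invertˡ-under [] (_ ∷ []) ι d g) (prefix-↭-∷ R q)

  invertˡ-under : ∀ Φ Ψ → Invˡ τ L R → (d : GT (Φ ++ Γ) (Ψ ++ Δ)) → Γ ↭ τ ∷ Γ₀ →
                  ⊢[ height d ] (Φ ++ L ++ Γ₀) ⇒ (Ψ ++ R ++ Δ)
  invertˡ-under {L = L} {R} Φ Ψ ι d g =
    ⊢-exchange (invertˡ ι d (prefix-↭-∷ Φ g)) (shifts L Φ) (shifts R Ψ)

  invertˡ-L∧ : Invˡ (φ ∧' ψ) L R → (d : GT (φ ∷ ψ ∷ Γ) Δ) →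
               ⊢[ suc (height d) ] (L ++ Γ) ⇒ (R ++ Δ)
  invertˡ-L∧ conj d              = ⊢-suc (atHeight d)
  invertˡ-L∧ (resolve (∧ₗ t)) d = ⊢L∧ (invertˡ (resolve t) d ↭-refl) ↭-refl
  invertˡ-L∧ (resolve (∧ᵣ t)) d = ⊢L∧ (invertˡ-under (_ ∷ []) [] (resolve t) d ↭-refl) ↭-refl

  invertˡ-L∨ : Invˡ (φ ∨' ψ) L R → All Classical Λ → (d : GT (φ ∷ Γ) Λ) (e : GT (ψ ∷ Γ) Λ) →
               Δ ↭ Λ ++ Δ₀ → ⊢[ suc (height d ⊔ height e) ] (L ++ Γ) ⇒ (R ++ Δ)
  invertˡ-L∨ disjₗ cΛ d e r = ⊢-⊔ˡ (⊢-exchange (⊢-weakenʳ _ (atHeight d)) ↭-refl (↭-sym r))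
  invertˡ-L∨ disjᵣ cΛ d e r = ⊢-⊔ʳ (⊢-exchange (⊢-weakenʳ _ (atHeight e)) ↭-refl (↭-sym r))
  invertˡ-L∨ (resolve (∨ₗ t)) cΛ d e r = ⊢L∨ cΛ (invertˡ (resolve t) d ↭-refl) (atHeight e) ↭-refl r
  invertˡ-L∨ (resolve (∨ᵣ t)) cΛ d e r = ⊢L∨ cΛ (atHeight d) (invertˡ (resolve t) e ↭-refl) ↭-refl r

  invertˡ-L⩔ : Invˡ τ L R → Split τ τ₁ τ₂ → (d : GT (τ₁ ∷ Γ) Δ) (e : GT (τ₂ ∷ Γ) Δ) →
               ⊢[ suc (height d ⊔ height e) ] (L ++ Γ) ⇒ (R ++ Δ)
  invertˡ-L⩔ conj (∧ₗ s) d e = ⊢L⩔ s (invertˡ conj d ↭-refl) (invertˡ conj e ↭-refl) ↭-refl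
  invertˡ-L⩔ conj (∧ᵣ s) d e =
    ⊢L⩔ s (⊢-swapˡ (invertˡ conj d ↭-refl)) (⊢-swapˡ (invertˡ conj e ↭-refl)) (↭-swap _ _ ↭-refl)
  invertˡ-L⩔ disjₗ (∨ₗ s) d e = ⊢L⩔ s (invertˡ disjₗ d ↭-refl) (invertˡ disjₗ e ↭-refl) ↭-refl
  invertˡ-L⩔ disjₗ (∨ᵣ s) d e = ⊢-⊔ˡ (invertˡ disjₗ d ↭-refl)
  invertˡ-L⩔ disjᵣ (∨ₗ s) d e = ⊢-⊔ˡ (invertˡ disjᵣ d ↭-refl)
  invertˡ-L⩔ disjᵣ (∨ᵣ s) d e = ⊢L⩔ s (invertˡ disjᵣ d ↭-refl) (invertˡ disjᵣ e ↭-refl) ↭-refl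
  invertˡ-L⩔ (resolve t) s d e with split-⇝-commute s t
  ... | from₁ r        = ⊢-⊔ˡ (invertˡ⁼ r d)
  ... | from₂ r        = ⊢-⊔ʳ (invertˡ⁼ r e)
  ... | both s' r₁ r₂ = ⊢L⩔ s' (invertˡ⁼ r₁ d) (invertˡ⁼ r₂ e) ↭-refl

  invertˡ⁼ : σ ⇝⁼ τ → (d : GT (σ ∷ Γ) Δ) → ⊢[ height d ] (τ ∷ Γ) ⇒ Δ
  invertˡ⁼ refl  d = atHeight d
  invertˡ⁼ [ t ] d = invertˡ (resolve t) d ↭-refl

data Invʳ : Fm → List Fm → List Fm → Set where
  neg   : {c : Classical α} → Invʳ (¬' α {c}) (α ∷ []) []
  conjₗ : Invʳ (φ ∧' ψ) [] (φ ∷ [])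
  conjᵣ : Invʳ (φ ∧' ψ) [] (ψ ∷ [])
  disj  : Invʳ (φ ∨' ψ) [] (φ ∷ ψ ∷ [])

Invʳ-atom : ∀ {p} → ¬ Invʳ (atom p) L R
Invʳ-atom ()

Invʳ-classical : Invʳ τ L R → Classical τ → All Classical R
Invʳ-classical neg _ = []
Invʳ-classical (conjₗ {φ = φ} {ψ}) c = proj₁ (∧-classical φ ψ c) ∷ []
Invʳ-classical (conjᵣ {φ = φ} {ψ}) c = proj₂ (∧-classical φ ψ c) ∷ []
Invʳ-classical (disj {φ = φ} {ψ}) c  = proj₁ (∧-classical φ ψ c) ∷ proj₂ (∧-classical φ ψ c) ∷ []

Invʳ-preserves-classical : Invʳ τ L R → Λ ↭ τ ∷ Λ₀ → All Classical Λ → All Classical (R ++ Λ₀)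
Invʳ-preserves-classical ι l cΛ with c ∷ cΛ₀ ← All-resp-↭ l cΛ = ++⁺ (Invʳ-classical ι c) cΛ₀

invertʳ-R¬ : {c : Classical α} → Invʳ (¬' α {c}) L R → (d : GT (α ∷ Γ) Δ) →
             ⊢[ suc (height d) ] (L ++ Γ) ⇒ (R ++ Δ)
invertʳ-R¬ neg d = ⊢-suc (atHeight d)

invertʳ-R∧ : Invʳ (φ ∧' ψ) L R → (d : GT Γ (φ ∷ Λ)) (e : GT Γ (ψ ∷ Λ)) →
             ⊢[ suc (height d ⊔ height e) ] (L ++ Γ) ⇒ (R ++ Λ ++ Δ)
invertʳ-R∧ conjₗ d e = ⊢-⊔ˡ (⊢-weakenʳ _ (atHeight d))
invertʳ-R∧ conjᵣ d e = ⊢-⊔ʳ (⊢-weakenʳ _ (atHeight e))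

invertʳ-R∨ : Invʳ (φ ∨' ψ) L R → (d : GT Γ (φ ∷ ψ ∷ Δ)) →
             ⊢[ suc (height d) ] (L ++ Γ) ⇒ (R ++ Δ)
invertʳ-R∨ disj d = ⊢-suc (atHeight d)

mutual
  invertʳ : Invʳ τ L R → (d : GT Γ Δ) → Δ ↭ τ ∷ Δ₀ → ⊢[ height d ] (L ++ Γ) ⇒ (R ++ Δ₀)
  invertʳ {L = L} {R} ι (ax p q₁ q₂) h with ↭-∷-overlap h q₂
  ... | inj₁ (refl , _) = ⊥-elim (Invʳ-atom ι)
  ... | inj₂ (_ , h₀ , _) = ax p (prefix-↭-∷ L q₁) (prefix-↭-∷ R h₀) , ≤-refl
  invertʳ {L = L} ι (ax⊥ q) h = ax⊥ (prefix-↭-∷ L q) , ≤-refl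
  invertʳ {L = L} ι (L¬ α d q) h = ⊢L¬ (invertʳ-under [] (α ∷ []) ι d h) (prefix-↭-∷ L q)
  invertʳ {R = R} ι (R¬ α d q) h with ↭-∷-overlap h q
  ... | inj₁ (refl , h₀) = ⊢-exchange (invertʳ-R¬ ι d) ↭-refl (++⁺ˡ R (↭-sym h₀))
  ... | inj₂ (_ , h₀ , h₁) = ⊢R¬ (invertʳ-under (α ∷ []) [] ι d h₁) (prefix-↭-∷ R h₀)
  invertʳ {L = L} ι (L∧ φ ψ d q) h = ⊢L∧ (invertʳ-under (φ ∷ ψ ∷ []) [] ι d h) (prefix-↭-∷ L q)
  invertʳ {L = L} {R} ι (R∧ {Λ = Λ} φ ψ cΛ d e q) h with ↭-∷-overlap h q
  ... | inj₁ (refl , h₀) = ⊢-exchange (invertʳ-R∧ ι d e) ↭-refl (++⁺ˡ R (↭-sym h₀))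
  ... | inj₂ (_ , h₀ , h₁) with ∷↭++-inv (↭-sym h₁)
  ...   | inj₁ (Λ₀ , l , h₂) =
    ⊢R∧ (Invʳ-preserves-classical ι l cΛ)
        (invertʳ-under [] (φ ∷ []) ι d l) (invertʳ-under [] (ψ ∷ []) ι e l)
        (↭-trans (prefix-↭-∷ R h₀) (↭-prep _ (↭-trans (++⁺ˡ R h₂) (↭-sym (++-assoc R Λ₀ _)))))
  ...   | inj₂ (_ , _ , h₂) =
    ⊢R∧ cΛ (⊢-weakenˡ [] L (atHeight d)) (⊢-weakenˡ [] L (atHeight e))
        (↭-trans (prefix-↭-∷ R h₀) (↭-prep _ (↭-trans (++⁺ˡ R h₂) (shifts R Λ))))
  invertʳ {L = L} {R} ι (L∨ {Λ = Λ} φ ψ cΛ d e q r) h with ∷↭++-inv (↭-trans (↭-sym h) r)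
  ... | inj₁ (Λ₀ , l , h₂) =
    ⊢L∨ (Invʳ-preserves-classical ι l cΛ)
        (invertʳ-under (φ ∷ []) [] ι d l) (invertʳ-under (ψ ∷ []) [] ι e l)
        (prefix-↭-∷ L q) (↭-trans (++⁺ˡ R h₂) (↭-sym (++-assoc R Λ₀ _)))
  ... | inj₂ (_ , _ , h₂) =
    ⊢L∨ cΛ (⊢-weakenˡ (φ ∷ []) L (atHeight d)) (⊢-weakenˡ (ψ ∷ []) L (atHeight e))
        (prefix-↭-∷ L q) (↭-trans (++⁺ˡ R h₂) (shifts R Λ))
  invertʳ {R = R} ι (R∨ φ ψ d q) h with ↭-∷-overlap h q
  ... | inj₁ (refl , h₀) = ⊢-exchange (invertʳ-R∨ ι d) ↭-refl (++⁺ˡ R (↭-sym h₀))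
  ... | inj₂ (_ , h₀ , h₁) = ⊢R∨ (invertʳ-under [] (φ ∷ ψ ∷ []) ι d h₁) (prefix-↭-∷ R h₀)
  invertʳ {L = L} ι (L⩔ χ φ ψ d e q) h =
    ⊢L⩔ (⟦⟧-split χ φ ψ) (invertʳ-under (_ ∷ []) [] ι d h) (invertʳ-under (_ ∷ []) [] ι e h)
        (prefix-↭-∷ L q)
  invertʳ {R = R} ι (R⩔L χ φ ψ d q) h with ↭-∷-overlap h q
  ... | inj₁ (refl , h₀) =
    ⊢-exchange (invertʳ-R⩔ ι (⟦⟧-⇝ₗ χ φ ψ) d) ↭-refl (++⁺ˡ R (↭-sym h₀))
  ... | inj₂ (_ , h₀ , h₁) =
    ⊢R⩔ (⟦⟧-⇝ₗ χ φ ψ) (invertʳ-under [] (_ ∷ []) ι d h₁) (prefix-↭-∷ R h₀)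
  invertʳ {R = R} ι (R⩔R χ φ ψ d q) h with ↭-∷-overlap h q
  ... | inj₁ (refl , h₀) =
    ⊢-exchange (invertʳ-R⩔ ι (⟦⟧-⇝ᵣ χ φ ψ) d) ↭-refl (++⁺ˡ R (↭-sym h₀))
  ... | inj₂ (_ , h₀ , h₁) =
    ⊢R⩔ (⟦⟧-⇝ᵣ χ φ ψ) (invertʳ-under [] (_ ∷ []) ι d h₁) (prefix-↭-∷ R h₀)

  invertʳ-under : ∀ Φ Ψ → Invʳ τ L R → (d : GT (Φ ++ Γ) (Ψ ++ Δ)) → Δ ↭ τ ∷ Δ₀ →
                  ⊢[ height d ] (Φ ++ L ++ Γ) ⇒ (Ψ ++ R ++ Δ₀)
  invertʳ-under {L = L} {R} Φ Ψ ι d h =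
    ⊢-exchange (invertʳ ι d (prefix-↭-∷ Ψ h)) (shifts L Φ) (shifts R Ψ)

  invertʳ-R⩔ : Invʳ τ L R → τ ⇝ σ → (d : GT Γ (σ ∷ Δ)) →
               ⊢[ suc (height d) ] (L ++ Γ) ⇒ (R ++ Δ)
  invertʳ-R⩔ conjₗ (∧ₗ t) d = ⊢R⩔ t (invertʳ conjₗ d ↭-refl) ↭-refl
  invertʳ-R⩔ conjₗ (∧ᵣ t) d = ⊢-suc (invertʳ conjₗ d ↭-refl)
  invertʳ-R⩔ conjᵣ (∧ₗ t) d = ⊢-suc (invertʳ conjᵣ d ↭-refl)
  invertʳ-R⩔ conjᵣ (∧ᵣ t) d = ⊢R⩔ t (invertʳ conjᵣ d ↭-refl) ↭-refl
  invertʳ-R⩔ disj  (∨ₗ t) d = ⊢R⩔ t (invertʳ disj d ↭-refl) ↭-refl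
  invertʳ-R⩔ disj  (∨ᵣ t) d = ⊢R⩔ t (⊢-swapʳ (invertʳ disj d ↭-refl)) (↭-swap _ _ ↭-refl)

Resolved : ℕ → List Fm → Fm → Fm → List Fm → Set
Resolved n Γ τ₁ τ₂ Δ = ⊢[ n ] Γ ⇒ (τ₁ ∷ Δ) ⊎ ⊢[ n ] Γ ⇒ (τ₂ ∷ Δ)

Resolved-map : (f : Fm → Fm) → (∀ {σ} → ⊢[ m ] Γ ⇒ (σ ∷ Δ) → ⊢[ n ] Γ' ⇒ (f σ ∷ Δ')) →
               Resolved m Γ τ₁ τ₂ Δ → Resolved n Γ' (f τ₁) (f τ₂) Δ'
Resolved-map f g = map⊎ g g

Resolved-resp-↭ : Δ ↭ Δ' → Resolved n Γ τ₁ τ₂ Δ → Resolved n Γ τ₁ τ₂ Δ'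
Resolved-resp-↭ h = Resolved-map id (λ r → ⊢-exchange r ↭-refl (↭-prep _ h))

mutual
  resolveʳ : All Classical Γ → Split τ τ₁ τ₂ → (d : GT Γ Δ) → Δ ↭ τ ∷ Δ₀ →
             Resolved (height d) Γ τ₁ τ₂ Δ₀
  resolveʳ cΓ s (ax p q₁ q₂) h with ↭-∷-overlap h q₂
  ... | inj₁ (refl , _) = ⊥-elim (split-nonclassical s tt)
  ... | inj₂ (_ , h₀ , _) = inj₁ (ax p q₁ (prefix-↭-∷ (_ ∷ []) h₀) , ≤-refl)
  resolveʳ cΓ s (ax⊥ q) h = inj₁ (ax⊥ q , ≤-refl)
  resolveʳ cΓ s (L¬ α d q) h =
    Resolved-map id (λ r → ⊢L¬ (⊢-swapʳ r) q)
                 (resolveʳ (tail (All-resp-↭ q cΓ)) s d (prefix-↭-∷ (α ∷ []) h))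
  resolveʳ cΓ s (R¬ α {c} d q) h with ↭-∷-overlap h q
  ... | inj₁ (refl , _) = ⊥-elim (split-nonclassical s tt)
  ... | inj₂ (_ , h₀ , h₁) =
    Resolved-map id (λ r → ⊢R¬ r (prefix-↭-∷ (_ ∷ []) h₀)) (resolveʳ (c ∷ cΓ) s d h₁)
  resolveʳ cΓ s (L∧ φ ψ d q) h with c ∷ cΓ₀ ← All-resp-↭ q cΓ =
    Resolved-map id (λ r → ⊢L∧ r q) (resolveʳ (proj₁ cφψ ∷ proj₂ cφψ ∷ cΓ₀) s d h)
    where cφψ = ∧-classical φ ψ c
  resolveʳ cΓ s (R∧ {Λ = Λ} φ ψ cΛ d e q) h with ↭-∷-overlap h q
  ... | inj₁ (refl , h₀) = Resolved-resp-↭ (↭-sym h₀) (resolveʳ-R∧ cΓ cΛ s d e)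
  ... | inj₂ (_ , h₀ , h₁) with ∷↭++-inv (↭-sym h₁)
  ...   | inj₁ (_ , l , _) = ⊥-elim (split-nonclassical s (head (All-resp-↭ l cΛ)))
  ...   | inj₂ (Δ₁ , _ , h₂) =
    inj₁ (⊢R∧ cΛ (atHeight d) (atHeight e)
              (↭-trans (prefix-↭-∷ (_ ∷ []) h₀)
                       (↭-prep _ (↭-trans (↭-prep _ h₂) (↭-sym (shift _ Λ Δ₁))))))
  resolveʳ cΓ s (L∨ {Λ = Λ} φ ψ cΛ d e q r) h with ∷↭++-inv (↭-trans (↭-sym h) r)
  ... | inj₁ (_ , l , _) = ⊥-elim (split-nonclassical s (head (All-resp-↭ l cΛ)))
  ... | inj₂ (Δ₁ , _ , h₂) =
    inj₁ (⊢L∨ cΛ (atHeight d) (atHeight e) q (↭-trans (↭-prep _ h₂) (↭-sym (shift _ Λ Δ₁))))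
  resolveʳ cΓ s (R∨ φ ψ d q) h with ↭-∷-overlap h q
  ... | inj₁ (refl , h₀) = Resolved-resp-↭ (↭-sym h₀) (resolveʳ-R∨ cΓ s d)
  ... | inj₂ (C , h₀ , h₁) =
    Resolved-map id (λ r → ⊢R∨ (⊢-exchange r ↭-refl (↭-sym (shift _ (φ ∷ ψ ∷ []) C)))
                                (prefix-↭-∷ (_ ∷ []) h₀))
                 (resolveʳ cΓ s d (prefix-↭-∷ (φ ∷ ψ ∷ []) h₁))
  resolveʳ cΓ s (L⩔ χ φ ψ d e q) h =
    ⊥-elim (split-nonclassical (⟦⟧-split χ φ ψ) (head (All-resp-↭ q cΓ)))
  resolveʳ cΓ s (R⩔L χ φ ψ d q) h with ↭-∷-overlap h q
  ... | inj₁ (refl , h₀) = Resolved-resp-↭ (↭-sym h₀) (resolveʳ-R⩔ cΓ s (⟦⟧-⇝ₗ χ φ ψ) d)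
  ... | inj₂ (_ , h₀ , h₁) =
    Resolved-map id (λ r → ⊢R⩔ (⟦⟧-⇝ₗ χ φ ψ) (⊢-swapʳ r) (prefix-↭-∷ (_ ∷ []) h₀))
                 (resolveʳ cΓ s d (prefix-↭-∷ (_ ∷ []) h₁))
  resolveʳ cΓ s (R⩔R χ φ ψ d q) h with ↭-∷-overlap h q
  ... | inj₁ (refl , h₀) = Resolved-resp-↭ (↭-sym h₀) (resolveʳ-R⩔ cΓ s (⟦⟧-⇝ᵣ χ φ ψ) d)
  ... | inj₂ (_ , h₀ , h₁) =
    Resolved-map id (λ r → ⊢R⩔ (⟦⟧-⇝ᵣ χ φ ψ) (⊢-swapʳ r) (prefix-↭-∷ (_ ∷ []) h₀))
                 (resolveʳ cΓ s d (prefix-↭-∷ (_ ∷ []) h₁))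

  resolveʳ-R∧ : All Classical Γ → All Classical Λ → Split (φ ∧' ψ) τ₁ τ₂ →
                (d : GT Γ (φ ∷ Λ)) (e : GT Γ (ψ ∷ Λ)) →
                Resolved (suc (height d ⊔ height e)) Γ τ₁ τ₂ (Λ ++ Δ)
  resolveʳ-R∧ cΓ cΛ (∧ₗ s) d e =
    Resolved-map (_∧' _) (λ r → ⊢R∧ cΛ r (atHeight e) ↭-refl) (resolveʳ cΓ s d ↭-refl)
  resolveʳ-R∧ cΓ cΛ (∧ᵣ s) d e =
    Resolved-map (_ ∧'_) (λ r → ⊢R∧ cΛ (atHeight d) r ↭-refl) (resolveʳ cΓ s e ↭-refl)

  resolveʳ-R∨ : All Classical Γ → Split (φ ∨' ψ) τ₁ τ₂ → (d : GT Γ (φ ∷ ψ ∷ Δ)) →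
                Resolved (suc (height d)) Γ τ₁ τ₂ Δ
  resolveʳ-R∨ cΓ (∨ₗ s) d = Resolved-map (_∨' _) (λ r → ⊢R∨ r ↭-refl) (resolveʳ cΓ s d ↭-refl)
  resolveʳ-R∨ cΓ (∨ᵣ s) d =
    Resolved-map (_ ∨'_) (λ r → ⊢R∨ (⊢-swapʳ r) ↭-refl) (resolveʳ cΓ s d (↭-swap _ _ ↭-refl))

  resolveʳ-R⩔ : All Classical Γ → Split τ τ₁ τ₂ → τ ⇝ σ → (d : GT Γ (σ ∷ Δ)) →
                Resolved (suc (height d)) Γ τ₁ τ₂ Δ
  resolveʳ-R⩔ cΓ s t d with split-⇝-commute s t
  ... | from₁ r        = inj₁ (⊢R⩔⁼ r (atHeight d))
  ... | from₂ r        = inj₂ (⊢R⩔⁼ r (atHeight d))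
  ... | both s' r₁ r₂ = map⊎ (⊢R⩔⁼ r₁) (⊢R⩔⁼ r₂) (resolveʳ cΓ s' d ↭-refl)

⊢-invertˡ : Invˡ τ L R → ⊢[ n ] (τ ∷ Γ) ⇒ Δ → ⊢[ n ] (L ++ Γ) ⇒ (R ++ Δ)
⊢-invertˡ ι (d , h) = ⊢-mono h (invertˡ ι d ↭-refl)

⊢-invertʳ : Invʳ τ L R → ⊢[ n ] Γ ⇒ (τ ∷ Δ) → ⊢[ n ] (L ++ Γ) ⇒ (R ++ Δ)
⊢-invertʳ ι (d , h) = ⊢-mono h (invertʳ ι d ↭-refl)

⊢-resolveʳ : All Classical Γ → Split τ τ₁ τ₂ → ⊢[ n ] Γ ⇒ (τ ∷ Δ) → Resolved n Γ τ₁ τ₂ Δ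
⊢-resolveʳ cΓ s (d , h) = map⊎ (⊢-mono h) (⊢-mono h) (resolveʳ cΓ s d ↭-refl)

mainTheorem3 :
      (∀ n Γ Δ α (c : Classical α) →
         ⊢[ n ] (¬' α {c} ∷ Γ) ⇒ Δ → ⊢[ n ] Γ ⇒ (α ∷ Δ))
    × (∀ n Γ Δ α (c : Classical α) →
         ⊢[ n ] Γ ⇒ (¬' α {c} ∷ Δ) → ⊢[ n ] (α ∷ Γ) ⇒ Δ)
    × (∀ n Γ Δ φ ψ →
         ⊢[ n ] ((φ ∧' ψ) ∷ Γ) ⇒ Δ → ⊢[ n ] (φ ∷ ψ ∷ Γ) ⇒ Δ)
    × (∀ n Γ Δ φ ψ →
         ⊢[ n ] Γ ⇒ ((φ ∧' ψ) ∷ Δ) → ⊢[ n ] Γ ⇒ (φ ∷ Δ) × ⊢[ n ] Γ ⇒ (ψ ∷ Δ))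
    × (∀ n Γ Δ φ ψ →
         ⊢[ n ] ((φ ∨' ψ) ∷ Γ) ⇒ Δ → ⊢[ n ] (φ ∷ Γ) ⇒ Δ × ⊢[ n ] (ψ ∷ Γ) ⇒ Δ)
    × (∀ n Γ Δ φ ψ →
         ⊢[ n ] Γ ⇒ ((φ ∨' ψ) ∷ Δ) → ⊢[ n ] Γ ⇒ (φ ∷ ψ ∷ Δ))
    × (∀ n Γ Δ χ φL φR →
         ⊢[ n ] (χ ⟦ φL ⩔ φR ⟧ ∷ Γ) ⇒ Δ →
         ⊢[ n ] (χ ⟦ φL ⟧ ∷ Γ) ⇒ Δ × ⊢[ n ] (χ ⟦ φR ⟧ ∷ Γ) ⇒ Δ)
    × (∀ n (Ξ : List Fm) Δ χ φL φR → All Classical Ξ →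
         ⊢[ n ] Ξ ⇒ (χ ⟦ φL ⩔ φR ⟧ ∷ Δ) →
         ⊢[ n ] Ξ ⇒ (χ ⟦ φL ⟧ ∷ Δ) ⊎ ⊢[ n ] Ξ ⇒ (χ ⟦ φR ⟧ ∷ Δ))
mainTheorem3 =
    (λ _ _ _ _ _ → ⊢-invertˡ neg)
  , (λ _ _ _ _ _ → ⊢-invertʳ neg)
  , (λ _ _ _ _ _ → ⊢-invertˡ conj)
  , (λ _ _ _ _ _ d → ⊢-invertʳ conjₗ d , ⊢-invertʳ conjᵣ d)
  , (λ _ _ _ _ _ d → ⊢-invertˡ disjₗ d , ⊢-invertˡ disjᵣ d)
  , (λ _ _ _ _ _ → ⊢-invertʳ disj)
  , (λ _ _ _ χ φL φR d →
       ⊢-invertˡ (resolve (⟦⟧-⇝ₗ χ φL φR)) d , ⊢-invertˡ (resolve (⟦⟧-⇝ᵣ χ φL φR)) d)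
  , (λ _ _ _ χ φL φR cΞ → ⊢-resolveʳ cΞ (⟦⟧-split χ φL φR))
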